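{- Let $x$ be a variable and let $t\in\mathrm{CL}(\mathcal{B})$ be $T$-normal. Then $[x]_T t$ is $T$-normal.
   Context: Lambda-terms are considered up to $\alpha$-equivalence; $\mathrm{FV}(t)$ is the set of free variables of $t$. Fix the combinators $\mathsf{S}=\lambda xyz.xz(yz)$, $\mathsf{K}=\lambda xy.x$, $\mathsf{I}=\lambda x.x$, $\mathsf{B}=\lambda xyz.x(yz)$, $\mathsf{C}=\lambda xyz.xzy$, $\mathsf{S}'=\lambda kxyz.k(xz)(yz)$, $\mathsf{B}'=\lambda kxyz.kx(yz)$, $\mathsf{C}'=\lambda kxyz.k(xz)y$. Let $\mathcal{B}=\{\mathsf{S},\mathsf{K},\mathsf{I},\mathsf{B},\mathsf{C},\mathsf{S}',\mathsf{B}',\mathsf{C}'\}$ and let $\mathrm{CL}(\mathcal{B})$ be the set of terms built from variables and elements of $\mathcal{B}$ using only application (left-associative); equality of such terms is syntactic, combinators treated as atoms. A term is $T$-normal if it contains no subterm of the form $\mathsf{K}t_1t_2$, $\mathsf{I}t$, $\mathsf{B}t_1t_2t_3$ or $\mathsf{B}'t_1t_2t_3t_4$. Algorithm $T$: for a variable $x$ and $t\in\mathrm{CL}(\mathcal{B})$, $[x]_T t$ is given by the first applicable equation: (1) $[x]_T t=\mathsf{K}t$ if $x\notin\mathrm{FV}(t)$; (2) $[x]_T x=\mathsf{I}$; (3) $[x]_T (s x)=s$ if $x\notin\mathrm{FV}(s)$; (4) $[x]_T (u x t)=\mathsf{C}ut$ if $x\notin\mathrm{FV}(ut)$; (5) $[x]_T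 (u x t)=\mathsf{S}u([x]_T t)$ if $x\notin\mathrm{FV}(u)$; (6) $[x]_T (u s t)=\mathsf{B}'us([x]_T t)$ if $x\notin\mathrm{FV}(us)$; (7) $[x]_T (u s t)=\mathsf{C}'u([x]_T s)t$ if $x\notin\mathrm{FV}(ut)$; (8) $[x]_T (u s t)=\mathsf{S}'u([x]_T s)([x]_T t)$ if $x\notin\mathrm{FV}(u)$; (9) $[x]_T (s t)=\mathsf{B}s([x]_T t)$ if $x\notin\mathrm{FV}(s)$; (10) $[x]_T (s t)=\mathsf{C}([x]_T s)t$ if $x\notin\mathrm{FV}(t)$; (11) $[x]_T (s t)=\mathsf{S}([x]_T s)([x]_T t)$. -}

module Defs where

open import Data.Nat using (ℕ; _≟_)
open import Data.Bool using (Bool; true; false; _∨_; not)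
open import Data.Empty using (⊥)
open import Data.Unit using (⊤)
open import Data.Product using (_×_)
open import Relation.Nullary.Decidable using (does)

data Comb : Set where
  S K I B C S′ B′ C′ : Comb

data Term : Set where
  var  : ℕ → Term
  comb : Comb → Term
  _·_  : Term → Term → Term

infixl 9 _·_

-- x occurs free in t (no binders in CL, so free = occurs)
occurs : ℕ → Term → Bool
occurs x (var y)  = does (x ≟ y)
occurs x (comb c) = false
occurs x (s · t)  = occurs x s ∨ occurs x t

_∈FV_ : ℕ → Term → Set
x ∈FV t with occurs x t
... | true  = ⊤
... | false = ⊥

IsRedex : Term → Set
IsRedex (comb K · _ · _)         = ⊤
IsRedex (comb I · _)             = ⊤
IsRedex (comb B · _ · _ · _)     = ⊤
IsRedex (comb B′ · _ · _ · _ · _) = ⊤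
IsRedex _                        = ⊥

data _⊑_ : Term → Term → Set where
  here   : ∀ {t} → t ⊑ t
  inLeft  : ∀ {u s t} → u ⊑ s → u ⊑ (s · t)
  inRight : ∀ {u s t} → u ⊑ t → u ⊑ (s · t)

TNormal : Term → Set
TNormal t = ∀ u → u ⊑ t → IsRedex u → ⊥

-- Algorithm T: [x]_T t, first applicable equation.
abstrT : ℕ → Term → Term
abstrT x t with occurs x t
abstrT x t | false = comb K · t
abstrT x (var y) | true = comb I                                   -- (2) (occurs ⇒ y = x)
abstrT x (comb c) | true = comb K · comb c                          -- impossible case
abstrT x (s · t) | true = app s t
  where
  general : Term
  general with occurs x s | occurs x t
  ... | false | _     = comb B · s · abstrT x t
  ... | true  | false = comb C · abstrT x s · t
  ... | true  | true  = comb S · abstrT x s · abstrT x t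

  isX : Term → Bool
  isX (var y) = does (x ≟ y)
  isX _       = false

  three : Term → Term → Term
  three u s′ with occurs x u | isX s′ | occurs x s′ | occurs x t
  ... | false | true  | _     | false = comb C · u · t
  ... | false | true  | _     | true  = comb S · u · abstrT x t
  ... | false | false | false | _     = comb B′ · u · s′ · abstrT x t
  ... | false | false | true  | false = comb C′ · u · abstrT x s′ · t
  ... | false | false | true  | true  = comb S′ · u · abstrT x s′ · abstrT x t
  ... | true  | _     | _     | _     = general

  app : Term → Term → Term
  app s t with isX t | occurs x s
  ... | true | false = s
  app (u · s′) t | _ | _ = three u s′
  app s t | _ | _ = general

-- Every right-hand side of algorithm T is a combinator applied to too few
-- arguments to form a forbidden redex (K to one, I to none, S, C, B to
-- two, S′, B′, C′ to three), and each argument is either a subterm of t or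
-- [x]_T r for a proper subterm r of t.

module Submission where

open import Data.Nat using (ℕ)
open import Data.Bool using (true; false)
open import Relation.Nullary using (¬_)
open import Defs

infix 4 _⊏_

data _⊏_ : Term → Term → Set where
  left  : ∀ {r s t} → r ⊑ s → r ⊏ s · t
  right : ∀ {r s t} → r ⊑ t → r ⊏ s · t

comb-normal : ∀ {c} → TNormal (comb c)
comb-normal _ here ()

·-normal : ∀ {s t} → TNormal s → TNormal t → ¬ IsRedex (s · t) → TNormal (s · t)
·-normal ns nt irreducible _ here        = irreducible
·-normal ns nt irreducible u (inLeft p)  = ns u p
·-normal ns nt irreducible u (inRight p) = nt u p

·-normalˡ : ∀ {s t} → TNormal (s · t) → TNormal s
·-normalˡ n u p = n u (inLeft p)

·-normalʳ : ∀ {s t} → TNormal (s · t) → TNormal t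
·-normalʳ n u p = n u (inRight p)

data Unsaturated₂ : Comb → Set where
  S : Unsaturated₂ S
  C : Unsaturated₂ C
  B : Unsaturated₂ B

data Unsaturated₃ : Comb → Set where
  S′ : Unsaturated₃ S′
  B′ : Unsaturated₃ B′
  C′ : Unsaturated₃ C′

unsaturated₂-normal : ∀ {c a b} → Unsaturated₂ c → TNormal a → TNormal b
                    → TNormal (comb c · a · b)
unsaturated₂-normal S na nb = ·-normal (·-normal comb-normal na λ ()) nb λ ()
unsaturated₂-normal C na nb = ·-normal (·-normal comb-normal na λ ()) nb λ ()
unsaturated₂-normal B na nb = ·-normal (·-normal comb-normal na λ ()) nb λ ()

unsaturated₃-normal : ∀ {c a b d} → Unsaturated₃ c → TNormal a → TNormal b → TNormal d
                    → TNormal (comb c · a · b · d)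
unsaturated₃-normal S′ na nb nd = ·-normal (·-normal (·-normal comb-normal na λ ()) nb λ ()) nd λ ()
unsaturated₃-normal B′ na nb nd = ·-normal (·-normal (·-normal comb-normal na λ ()) nb λ ()) nd λ ()
unsaturated₃-normal C′ na nb nd = ·-normal (·-normal (·-normal comb-normal na λ ()) nb λ ()) nd λ ()

-- Rule x t r: [x]_T t = r is an instance of equation (n) of algorithm T
-- (constructor ruleₙ), its side condition aside.
data Rule (x : ℕ) : Term → Term → Set where
  rule₁  : ∀ {t} → Rule x t (comb K · t)
  rule₂  : ∀ {y} → Rule x (var y) (comb I)
  rule₃  : ∀ {s t} → Rule x (s · t) s
  rule₄  : ∀ {u s t} → Rule x (u · s · t) (comb C · u · t)
  rule₅  : ∀ {u s t} → Rule x (u · s · t) (comb S · u · abstrT x t)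
  rule₆  : ∀ {u s t} → Rule x (u · s · t) (comb B′ · u · s · abstrT x t)
  rule₇  : ∀ {u s t} → Rule x (u · s · t) (comb C′ · u · abstrT x s · t)
  rule₈  : ∀ {u s t} → Rule x (u · s · t) (comb S′ · u · abstrT x s · abstrT x t)
  rule₉  : ∀ {s t} → Rule x (s · t) (comb B · s · abstrT x t)
  rule₁₀ : ∀ {s t} → Rule x (s · t) (comb C · abstrT x s · t)
  rule₁₁ : ∀ {s t} → Rule x (s · t) (comb S · abstrT x s · abstrT x t)

rule-normal : ∀ {x t r} → TNormal t → (∀ {r} → r ⊏ t → TNormal (abstrT x r))
            → Rule x t r → TNormal r
rule-normal nt ih rule₁  = ·-normal comb-normal nt λ ()
rule-normal nt ih rule₂  = comb-normal
rule-normal nt ih rule₃  = ·-normalˡ nt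
rule-normal nt ih rule₄  = unsaturated₂-normal C (·-normalˡ (·-normalˡ nt)) (·-normalʳ nt)
rule-normal nt ih rule₅  = unsaturated₂-normal S (·-normalˡ (·-normalˡ nt)) (ih (right here))
rule-normal nt ih rule₆  =
  unsaturated₃-normal B′ (·-normalˡ (·-normalˡ nt)) (·-normalʳ (·-normalˡ nt)) (ih (right here))
rule-normal nt ih rule₇  =
  unsaturated₃-normal C′ (·-normalˡ (·-normalˡ nt)) (ih (left (inRight here))) (·-normalʳ nt)
rule-normal nt ih rule₈  =
  unsaturated₃-normal S′ (·-normalˡ (·-normalˡ nt)) (ih (left (inRight here))) (ih (right here))
rule-normal nt ih rule₉  = unsaturated₂-normal B (·-normalˡ nt) (ih (right here))
rule-normal nt ih rule₁₀ = unsaturated₂-normal C (ih (left here)) (·-normalʳ nt)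
rule-normal nt ih rule₁₁ = unsaturated₂-normal S (ih (left here)) (ih (right here))

-- The where-clauses of abstrT recompute the occurrence tests, so each test is
-- split again wherever abstrT re-evaluates it; a branch contradicting an
-- earlier split is harmless, since every branch yields some rule.
rule-var· : ∀ x z t → Rule x (var z · t) (abstrT x (var z · t))
rule-var· x z t with occurs x (var z · t)
... | false = rule₁
rule-var· x z (var y) | true with occurs x (var y) | occurs x (var z)
... | true  | false = rule₃
... | true  | true  with occurs x (var z) | occurs x (var y)
...   | false | _     = rule₉
...   | true  | false = rule₁₀
...   | true  | true  = rule₁₁
rule-var· x z (var y) | true | false | _ with occurs x (var z) | occurs x (var y)
...   | false | _     = rule₉
...   | true  | false = rule₁₀
...   | true  | true  = rule₁₁
rule-var· x z (comb c) | true with occurs x (var z)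
... | false = rule₉
... | true  = rule₁₀
rule-var· x z (p · q)  | true with occurs x (var z) | occurs x (p · q)
... | false | _     = rule₉
... | true  | false = rule₁₀
... | true  | true  = rule₁₁

rule-comb· : ∀ x c t → Rule x (comb c · t) (abstrT x (comb c · t))
rule-comb· x c t with occurs x (comb c · t)
... | false = rule₁
rule-comb· x c (var y) | true with occurs x (var y)
... | true  = rule₃
... | false = rule₉
rule-comb· x c (comb d) | true = rule₉
rule-comb· x c (p · q)  | true = rule₉

rule-·var· : ∀ x u w t → Rule x (u · var w · t) (abstrT x (u · var w · t))
rule-·var· x u w t with occurs x (u · var w · t)
... | false = rule₁
rule-·var· x u w (var y) | true with occurs x (var y) | occurs x (u · var w)
... | true  | false = rule₃
... | true  | true  with occurs x u | occurs x (var w) | occurs x (var y)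
...   | false | true  | false = rule₄
...   | false | true  | true  = rule₅
...   | false | false | _     = rule₆
...   | true  | _     | _     with occurs x (u · var w) | occurs x (var y)
...     | false | _     = rule₉
...     | true  | false = rule₁₀
...     | true  | true  = rule₁₁
rule-·var· x u w (var y) | true | false | _ with occurs x u | occurs x (var w) | occurs x (var y)
...   | false | true  | false = rule₄
...   | false | true  | true  = rule₅
...   | false | false | _     = rule₆
...   | true  | _     | _     with occurs x (u · var w) | occurs x (var y)
...     | false | _     = rule₉
...     | true  | false = rule₁₀
...     | true  | true  = rule₁₁
rule-·var· x u w (comb c) | true with occurs x u | occurs x (var w)
... | false | true  = rule₄
... | false | false = rule₆
... | true  | _     with occurs x (u · var w)
...   | false = rule₉
...   | true  = rule₁₀
rule-·var· x u w (p · q) | true with occurs x u | occurs x (var w) | occurs x (p · q)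
... | false | true  | false = rule₄
... | false | true  | true  = rule₅
... | false | false | _     = rule₆
... | true  | _     | _     with occurs x (u · var w) | occurs x (p · q)
...   | false | _     = rule₉
...   | true  | false = rule₁₀
...   | true  | true  = rule₁₁

rule-·comb· : ∀ x u c t → Rule x (u · comb c · t) (abstrT x (u · comb c · t))
rule-·comb· x u c t with occurs x (u · comb c · t)
... | false = rule₁
rule-·comb· x u c (var y) | true with occurs x (var y) | occurs x (u · comb c)
... | true  | false = rule₃
... | true  | true  with occurs x u
...   | false = rule₆
...   | true  with occurs x (u · comb c) | occurs x (var y)
...     | false | _     = rule₉
...     | true  | false = rule₁₀
...     | true  | true  = rule₁₁
rule-·comb· x u c (var y) | true | false | _ with occurs x u
...   | false = rule₆
...   | true  with occurs x (u · comb c) | occurs x (var y)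
...     | false | _     = rule₉
...     | true  | false = rule₁₀
...     | true  | true  = rule₁₁
rule-·comb· x u c (comb d) | true with occurs x u
... | false = rule₆
... | true  with occurs x (u · comb c)
...   | false = rule₉
...   | true  = rule₁₀
rule-·comb· x u c (p · q) | true with occurs x u
... | false = rule₆
... | true  with occurs x (u · comb c) | occurs x (p · q)
...   | false | _     = rule₉
...   | true  | false = rule₁₀
...   | true  | true  = rule₁₁

rule-·app· : ∀ x u p q t → Rule x (u · (p · q) · t) (abstrT x (u · (p · q) · t))
rule-·app· x u p q t with occurs x (u · (p · q) · t)
... | false = rule₁
rule-·app· x u p q (var y) | true with occurs x (var y) | occurs x (u · (p · q))
... | true  | false = rule₃
... | true  | true  with occurs x u | occurs x (p · q) | occurs x (var y)
...   | false | false | _     = rule₆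
...   | false | true  | false = rule₇
...   | false | true  | true  = rule₈
...   | true  | _     | _     with occurs x (u · (p · q)) | occurs x (var y)
...     | false | _     = rule₉
...     | true  | false = rule₁₀
...     | true  | true  = rule₁₁
rule-·app· x u p q (var y) | true | false | _ with occurs x u | occurs x (p · q) | occurs x (var y)
...   | false | false | _     = rule₆
...   | false | true  | false = rule₇
...   | false | true  | true  = rule₈
...   | true  | _     | _     with occurs x (u · (p · q)) | occurs x (var y)
...     | false | _     = rule₉
...     | true  | false = rule₁₀
...     | true  | true  = rule₁₁
rule-·app· x u p q (comb c) | true with occurs x u | occurs x (p · q)
... | false | false = rule₆
... | false | true  = rule₇
... | true  | _     with occurs x (u · (p · q))
...   | false = rule₉
...   | true  = rule₁₀
rule-·app· x u p q (r₁ · r₂) | true with occurs x u | occurs x (p · q) | occurs x (r₁ · r₂)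
... | false | false | _     = rule₆
... | false | true  | false = rule₇
... | false | true  | true  = rule₈
... | true  | _     | _     with occurs x (u · (p · q)) | occurs x (r₁ · r₂)
...   | false | _     = rule₉
...   | true  | false = rule₁₀
...   | true  | true  = rule₁₁

abstrT-rule : ∀ x t → Rule x t (abstrT x t)
abstrT-rule x (var y) with occurs x (var y)
... | false = rule₁
... | true  = rule₂
abstrT-rule x (comb c)              = rule₁
abstrT-rule x (var z · t)           = rule-var· x z t
abstrT-rule x (comb c · t)          = rule-comb· x c t
abstrT-rule x (u · var w · t)       = rule-·var· x u w t
abstrT-rule x (u · comb c · t)      = rule-·comb· x u c t
abstrT-rule x (u · (p · q) · t)     = rule-·app· x u p q t

abstrT-normal-⊑ : ∀ x t {r} → r ⊑ t → TNormal t → TNormal (abstrT x r)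
abstrT-normal-⊏ : ∀ x t {r} → r ⊏ t → TNormal t → TNormal (abstrT x r)

abstrT-normal-⊑ x t       here        nt =
  rule-normal nt (λ r⊏t → abstrT-normal-⊏ x t r⊏t nt) (abstrT-rule x t)
abstrT-normal-⊑ x (s · t) (inLeft p)  nt = abstrT-normal-⊑ x s p (·-normalˡ nt)
abstrT-normal-⊑ x (s · t) (inRight p) nt = abstrT-normal-⊑ x t p (·-normalʳ nt)

abstrT-normal-⊏ x (s · t) (left p)  nt = abstrT-normal-⊑ x s p (·-normalˡ nt)
abstrT-normal-⊏ x (s · t) (right p) nt = abstrT-normal-⊑ x t p (·-normalʳ nt)

mainTheorem11 : (x : ℕ) (t : Term) → TNormal t → TNormal (abstrT x t)
mainTheorem11 x t = abstrT-normal-⊑ x t here
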